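{- Let $(G,k)$ be a yes-instance of diamond-free editing and let $E_\pm=E_+\cup E_-$ be a solution of $(G,k)$. Let $u,v$ be distinct vertices of $G$. Then $uv\notin E_\pm$ if either (i) $uv\in E(G)$ and $N(u)\cap N(v)$ contains $k+1$ pairwise adjacent vertices; or (ii) $uv\notin E(G)$ and $N(u)\cap N(v)$ contains $k+1$ pairwise nonadjacent vertices.
   Context: Graphs are finite, simple, undirected; $N(v)$ is the set of neighbors of $v$ in $G$. A diamond is $K_4$ minus one edge; a graph is diamond-free if it has no induced diamond. For a set $E_+$ of non-edges of $G$ and a set $E_-$ of edges of $G$, write $E_\pm=E_+\cup E_-$ and $G\triangle E_\pm$ for the graph on $V(G)$ with edge set $(E(G)\cup E_+)\setminus E_-$. A solution of an instance $(G,k)$ (with $k\ge0$ an integer) of diamond-free editing is such a pair with $G\triangle E_\pm$ diamond-free and $|E_\pm|\le k$; $(G,k)$ is a yes-instance if a solution exists. -}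

module Defs where

open import Data.Nat using (ℕ; suc; _<_)
open import Data.Fin using (Fin; toℕ)
open import Data.Bool using (Bool; true; false; _∨_; _∧_; not; T)
open import Data.List using (List; length; filter; allFin; concatMap; map)
open import Data.Product using (_×_; _,_; proj₁; proj₂; ∃; Σ-syntax)
open import Relation.Nullary using (¬_; Dec)
open import Relation.Nullary.Decidable using (_×-dec_)
open import Data.Nat using (_<?_)
open import Data.Bool using (T?)
open import Relation.Binary.PropositionalEquality using (_≡_; _≢_)

record Graph (n : ℕ) : Set where
  field
    adj   : Fin n → Fin n → Bool
    sym   : ∀ u v → adj u v ≡ adj v u
    irref : ∀ u → adj u u ≡ false
open Graph public

Edge : ∀ {n} → Graph n → Fin n → Fin n → Set
Edge G u v = T (adj G u v)

record PairSet (n : ℕ) : Set where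
  field
    mem    : Fin n → Fin n → Bool
    memSym : ∀ u v → mem u v ≡ mem v u
    memIrr : ∀ u → mem u u ≡ false
open PairSet public

-- all ordered pairs (u , v) with u < v, i.e. the unordered pairs of distinct vertices
orderedPairs : (n : ℕ) → List (Fin n × Fin n)
orderedPairs n =
  filter (λ p → toℕ (proj₁ p) <? toℕ (proj₂ p))
    (concatMap (λ u → map (λ v → (u , v)) (allFin n)) (allFin n))

∣_∣ₚ : ∀ {n} → PairSet n → ℕ
∣_∣ₚ {n} S = length (filter (λ p → T? (mem S (proj₁ p) (proj₂ p))) (orderedPairs n))

_∪ₚ_ : ∀ {n} → PairSet n → PairSet n → PairSet n
mem    (A ∪ₚ B) u v = mem A u v ∨ mem B u v
memSym (A ∪ₚ B) u v rewrite memSym A u v | memSym B u v = Relation.Binary.PropositionalEquality.refl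
memIrr (A ∪ₚ B) u rewrite memIrr A u | memIrr B u = Relation.Binary.PropositionalEquality.refl

edit : ∀ {n} → Graph n → PairSet n → PairSet n → Graph n
adj   (edit G Ep Em) u v = (adj G u v ∨ mem Ep u v) ∧ not (mem Em u v)
sym   (edit G Ep Em) u v rewrite sym G u v | memSym Ep u v | memSym Em u v =
  Relation.Binary.PropositionalEquality.refl
irref (edit G Ep Em) u rewrite irref G u | memIrr Ep u =
  Relation.Binary.PropositionalEquality.refl

IsDiamond : ∀ {n} → Graph n → Fin n → Fin n → Fin n → Fin n → Set
IsDiamond G a b c d =
  a ≢ b × a ≢ c × a ≢ d × b ≢ c × b ≢ d × c ≢ d ×
  Edge G a b × Edge G a c × Edge G a d × Edge G b c × Edge G b d ×
  ¬ Edge G c d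

DiamondFree : ∀ {n} → Graph n → Set
DiamondFree G = ∀ a b c d → ¬ IsDiamond G a b c d

IsSolution : ∀ {n} → Graph n → ℕ → PairSet n → PairSet n → Set
IsSolution G k Ep Em =
  (∀ u v → T (mem Ep u v) → ¬ Edge G u v) ×
  (∀ u v → T (mem Em u v) → Edge G u v) ×
  DiamondFree (edit G Ep Em) ×
  Data.Nat._≤_ ∣ Ep ∪ₚ Em ∣ₚ k

CommonClique : ∀ {n} → Graph n → Fin n → Fin n → ℕ → Set
CommonClique {n} G u v m =
  Σ[ f ∈ (Fin m → Fin n) ]
    (∀ i → Edge G u (f i) × Edge G v (f i)) ×
    (∀ i j → i ≢ j → f i ≢ f j × Edge G (f i) (f j))

CommonIndep : ∀ {n} → Graph n → Fin n → Fin n → ℕ → Set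
CommonIndep {n} G u v m =
  Σ[ f ∈ (Fin m → Fin n) ]
    (∀ i → Edge G u (f i) × Edge G v (f i)) ×
    (∀ i j → i ≢ j → f i ≢ f j × ¬ Edge G (f i) (f j))

-- Suppose uv ∈ E± = D and let w₀ … w_k be the protecting common neighbours
-- (a clique of G if uv ∈ E(G), an independent set if uv ∉ E(G)).  Call wᵢ
-- untouched when neither uwᵢ nor vwᵢ is in D.  For two untouched wᵢ , wⱼ the
-- pair wᵢwⱼ must be in D, since otherwise {u, v, wᵢ, wⱼ} would induce a
-- diamond in G △ E± (diamond lemmas, via the description of G △ E± pair
-- by pair).  A purely combinatorial counting argument then finds k+1
-- pairwise different pairs in D: choose a hub c (untouched if possible) and
-- send i to uwᵢ or vwᵢ if wᵢ is touched, to uv if i = c, and to w_c wᵢ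
-- otherwise.  Counting is done by the pigeonhole principle on the list of
-- sorted pairs that defines ∣ D ∣ₚ.  Hence k < ∣ D ∣ₚ ≤ k, a contradiction.
module Submission where

open import Defs hiding (sym)
open import Data.Nat using (ℕ; suc; _≤_; _<_; _<?_)
open import Data.Nat.Properties using (≮⇒≥; ≤∧≢⇒<; <⇒≢; ≤-trans; 1+n≰n)
open import Data.Fin using (Fin; zero; toℕ; _≟_)
open import Data.Fin.Properties using (toℕ-injective; any?; pigeonhole)
open import Data.Bool using (true; false; T; _∨_; _∧_; not; T?)
open import Data.Sum using (_⊎_; inj₁; inj₂)
open import Data.Product using (_×_; _,_; proj₁; proj₂; ∃; Σ)
open import Data.Empty using (⊥-elim)
open import Data.Unit using (tt)
open import Data.List using (List; filter; lookup; map; allFin)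
open import Data.List.Relation.Unary.Any using (index)
import Data.List.Relation.Unary.Any as Any
open import Data.List.Relation.Unary.Any.Properties using (lookup-index)
open import Data.List.Membership.Propositional using (_∈_)
open import Data.List.Membership.Propositional.Properties
  using (∈-filter⁺; ∈-concatMap⁺; ∈-map⁺; ∈-allFin)
open import Function using (_∘_; _⇔_; mk⇔; Equivalence)
open import Relation.Nullary using (¬_; Dec; yes; no; ¬?)
open import Relation.Nullary.Decidable using (_×-dec_; decidable-stable)
open import Relation.Binary.PropositionalEquality
  using (_≡_; _≢_; refl; sym; trans; cong; subst; ≢-sym)

private
  variable
    n : ℕ

edge-sym : (H : Graph n) {a b : Fin n} → Edge H a b → Edge H b a
edge-sym H {a} {b} = subst T (Graph.sym H a b)

mem-sym : (D : PairSet n) {a b : Fin n} → T (mem D a b) → T (mem D b a)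
mem-sym D {a} {b} = subst T (memSym D a b)

adjacent-distinct : (H : Graph n) {a b : Fin n} → Edge H a b → a ≢ b
adjacent-distinct H {a} e refl = subst T (irref H a) e

Same : {A : Set} → A × A → A × A → Set
Same (a , b) (c , d) = (a ≡ c × b ≡ d) ⊎ (a ≡ d × b ≡ c)

Valid : PairSet n → Fin n × Fin n → Set
Valid D (a , b) = a ≢ b × T (mem D a b)

pairList : PairSet n → List (Fin n × Fin n)
pairList {n} D = filter (λ p → T? (mem D (proj₁ p) (proj₂ p))) (orderedPairs n)

orderedPairs-complete : {a b : Fin n} → toℕ a < toℕ b → (a , b) ∈ orderedPairs n
orderedPairs-complete {n} {a} {b} a<b =
  ∈-filter⁺ (λ p → toℕ (proj₁ p) <? toℕ (proj₂ p))
    (∈-concatMap⁺ (λ x → map (x ,_) (allFin n))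
      (Any.map (λ { refl → ∈-map⁺ (a ,_) (∈-allFin b) }) (∈-allFin a)))
    a<b

sort : Fin n → Fin n → Fin n × Fin n
sort a b with toℕ a <? toℕ b
... | yes _ = a , b
... | no  _ = b , a

sort-listed : (D : PairSet n) {a b : Fin n} → Valid D (a , b) → sort a b ∈ pairList D
sort-listed D {a} {b} (a≢b , ab∈D) with toℕ a <? toℕ b
... | yes a<b = ∈-filter⁺ _ (orderedPairs-complete a<b) ab∈D
... | no  a≮b = ∈-filter⁺ _ (orderedPairs-complete b<a) (mem-sym D ab∈D)
  where
  b<a : toℕ b < toℕ a
  b<a = ≤∧≢⇒< (≮⇒≥ a≮b) (λ e → a≢b (toℕ-injective (sym e)))

sort-injective : (a b c d : Fin n) → sort a b ≡ sort c d → Same (a , b) (c , d)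
sort-injective a b c d eq with toℕ a <? toℕ b | toℕ c <? toℕ d
... | yes _ | yes _ = inj₁ (cong proj₁ eq , cong proj₂ eq)
... | yes _ | no  _ = inj₂ (cong proj₁ eq , cong proj₂ eq)
... | no  _ | yes _ = inj₂ (cong proj₂ eq , cong proj₁ eq)
... | no  _ | no  _ = inj₁ (cong proj₂ eq , cong proj₁ eq)

-- A family of m pairwise different valid pairs shows m ≤ ∣ D ∣ₚ
-- (pigeonhole principle on their positions in pairList D).
pairs-count : (D : PairSet n) (m : ℕ) (h : Fin m → Fin n × Fin n) →
  (∀ i → Valid D (h i)) → (∀ i j → i ≢ j → ¬ Same (h i) (h j)) → m ≤ ∣ D ∣ₚ
pairs-count D m h valid different = ≮⇒≥ λ too-many →
  let (i , j , i<j , same-position) = pigeonhole too-many position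
  in different i j (λ i≡j → <⇒≢ i<j (cong toℕ i≡j))
       (sort-injective _ _ _ _ (trans (listed i)
         (trans (cong (lookup (pairList D)) same-position) (sym (listed j)))))
  where
  position : Fin m → Fin ∣ D ∣ₚ
  position i = index (sort-listed D (valid i))

  listed : (i : Fin m) → sort (proj₁ (h i)) (proj₂ (h i)) ≡ lookup (pairList D) (position i)
  listed i = lookup-index (sort-listed D (valid i))

Untouched : PairSet n → Fin n → Fin n → Fin n → Set
Untouched D u v x = ¬ T (mem D u x) × ¬ T (mem D v x)

module StarCount {k : ℕ} (D : PairSet n) (u v : Fin n)
  (u≢v : u ≢ v) (uv∈D : T (mem D u v))
  (w : Fin (suc k) → Fin n) (w-distinct : ∀ i j → i ≢ j → w i ≢ w j)
  (w≢u : ∀ i → w i ≢ u) (w≢v : ∀ i → w i ≢ v)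
  (untouched-joined : ∀ i j → i ≢ j →
     Untouched D u v (w i) → Untouched D u v (w j) → T (mem D (w i) (w j)))
  where

  w-injective : ∀ {i j} → w i ≡ w j → i ≡ j
  w-injective {i} {j} wi≡wj = decidable-stable (i ≟ j) (λ i≢j → w-distinct i j i≢j wi≡wj)

  Anchor : Fin (suc k) → Fin n → Set
  Anchor c x = x ≡ u ⊎ x ≡ v ⊎ x ≡ w c

  anchored-hub : ∀ {c j} → Anchor c (w j) → j ≡ c
  anchored-hub {j = j} (inj₁ wj≡u)        = ⊥-elim (w≢u j wj≡u)
  anchored-hub {j = j} (inj₂ (inj₁ wj≡v)) = ⊥-elim (w≢v j wj≡v)
  anchored-hub         (inj₂ (inj₂ wj≡wc)) = w-injective wj≡wc

  Shape : Fin (suc k) → Fin (suc k) → Fin n × Fin n → Set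
  Shape c i p = (p ≡ (u , v) × i ≡ c) ⊎ ∃ λ x → Anchor c x × p ≡ (x , w i)

  shapes-different : ∀ {c i j p q} → i ≢ j → Shape c i p → Shape c j q → ¬ Same p q
  shapes-different i≢j (inj₁ (_ , i≡c)) (inj₁ (_ , j≡c)) _ = i≢j (trans i≡c (sym j≡c))
  shapes-different {j = j} _ (inj₁ (refl , _)) (inj₂ (_ , _ , refl)) (inj₁ (_ , v≡wj)) =
    w≢v j (sym v≡wj)
  shapes-different {j = j} _ (inj₁ (refl , _)) (inj₂ (_ , _ , refl)) (inj₂ (u≡wj , _)) =
    w≢u j (sym u≡wj)
  shapes-different {i = i} _ (inj₂ (_ , _ , refl)) (inj₁ (refl , _)) (inj₁ (_ , wi≡v)) =
    w≢v i wi≡v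
  shapes-different {i = i} _ (inj₂ (_ , _ , refl)) (inj₁ (refl , _)) (inj₂ (_ , wi≡u)) =
    w≢u i wi≡u
  shapes-different i≢j (inj₂ (_ , _ , refl)) (inj₂ (_ , _ , refl)) (inj₁ (_ , wi≡wj)) =
    i≢j (w-injective wi≡wj)
  shapes-different i≢j (inj₂ (_ , ax , refl)) (inj₂ (_ , ay , refl)) (inj₂ (refl , refl)) =
    i≢j (trans (anchored-hub ay) (sym (anchored-hub ax)))

  untouched? : ∀ i → Dec (Untouched D u v (w i))
  untouched? i = ¬? (T? (mem D u (w i))) ×-dec ¬? (T? (mem D v (w i)))

  Hub : Fin (suc k) → Set
  Hub c = ∀ i → Untouched D u v (w i) → Untouched D u v (w c)

  hub : Σ (Fin (suc k)) Hub
  hub with any? untouched?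
  ... | yes (c , c-untouched) = c , λ _ _ → c-untouched
  ... | no  none              = zero , λ i i-untouched → ⊥-elim (none (i , i-untouched))

  star : ∀ {c} → Hub c → ∀ i → Σ (Fin n × Fin n) λ p → Shape c i p × Valid D p
  star {c} is-hub i with T? (mem D u (w i)) | T? (mem D v (w i)) | i ≟ c
  ... | yes uwᵢ∈D | _ | _ =
    (u , w i) , inj₂ (u , inj₁ refl , refl) , ≢-sym (w≢u i) , uwᵢ∈D
  ... | no _ | yes vwᵢ∈D | _ =
    (v , w i) , inj₂ (v , inj₂ (inj₁ refl) , refl) , ≢-sym (w≢v i) , vwᵢ∈D
  ... | no _ | no _ | yes i≡c =
    (u , v) , inj₁ (refl , i≡c) , u≢v , uv∈D
  ... | no uwᵢ∉D | no vwᵢ∉D | no i≢c =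
    (w c , w i) , inj₂ (w c , inj₂ (inj₂ refl) , refl) ,
    w-distinct c i (≢-sym i≢c) ,
    untouched-joined c i (≢-sym i≢c) (is-hub i (uwᵢ∉D , vwᵢ∉D)) (uwᵢ∉D , vwᵢ∉D)

  lower-bound : suc k ≤ ∣ D ∣ₚ
  lower-bound = pairs-count D (suc k) (proj₁ ∘ pair) (proj₂ ∘ proj₂ ∘ pair)
    (λ i j i≢j → shapes-different i≢j (proj₁ (proj₂ (pair i))) (proj₁ (proj₂ (pair j))))
    where
    pair : ∀ i → Σ (Fin n × Fin n) λ p → Shape (proj₁ hub) i p × Valid D p
    pair = star (proj₂ hub)

unedited-bool : ∀ g p m → ¬ T (p ∨ m) → T ((g ∨ p) ∧ not m) ⇔ T g
unedited-bool true  false false _ = mk⇔ (λ _ → tt) (λ _ → tt)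
unedited-bool false false false _ = mk⇔ (λ ()) (λ ())
unedited-bool _     true  _     out = ⊥-elim (out tt)
unedited-bool true  false true  out = ⊥-elim (out tt)
unedited-bool false false true  out = ⊥-elim (out tt)

edited-bool : ∀ g p m → (T p → ¬ T g) → (T m → T g) → T (p ∨ m) →
  T ((g ∨ p) ∧ not m) ⇔ (¬ T g)
edited-bool true  true  _     p⇒¬g _   _ = ⊥-elim (p⇒¬g tt tt)
edited-bool true  false true  _    _   _ = mk⇔ (λ ()) (λ ¬g → ⊥-elim (¬g tt))
edited-bool false _     true  _    m⇒g _ = ⊥-elim (m⇒g tt)
edited-bool false true  false _    _   _ = mk⇔ (λ _ ()) (λ _ → tt)

module Editing (G : Graph n) (Ep Em : PairSet n)
  (Ep-non-edges : ∀ a b → T (mem Ep a b) → ¬ Edge G a b)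
  (Em-edges : ∀ a b → T (mem Em a b) → Edge G a b)
  where

  D : PairSet n
  D = Ep ∪ₚ Em

  G′ : Graph n
  G′ = edit G Ep Em

  unedited-pair : ∀ {a b} → ¬ T (mem D a b) → Edge G′ a b ⇔ Edge G a b
  unedited-pair {a} {b} = unedited-bool (adj G a b) (mem Ep a b) (mem Em a b)

  edited-pair : ∀ {a b} → T (mem D a b) → Edge G′ a b ⇔ (¬ Edge G a b)
  edited-pair {a} {b} =
    edited-bool (adj G a b) (mem Ep a b) (mem Em a b) (Ep-non-edges a b) (Em-edges a b)

  kept-edge : ∀ {a b} → Edge G a b → ¬ T (mem D a b) → Edge G′ a b
  kept-edge ab ab∉D = Equivalence.from (unedited-pair ab∉D) ab

  untouched-edges : ∀ {u v x} → Edge G u x × Edge G v x → Untouched D u v x →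
    Edge G′ u x × Edge G′ v x
  untouched-edges (ux , vx) (ux∉D , vx∉D) = kept-edge ux ux∉D , kept-edge vx vx∉D

  -- Case (i): uv deleted, x y adjacent common neighbours untouched.  Unless
  -- xy is edited as well, {x , y , u , v} induces a diamond in G′.
  clique-pair-edited : DiamondFree G′ → ∀ {u v x y} → u ≢ v →
    Edge G u v → T (mem D u v) → x ≢ y →
    Edge G u x × Edge G v x → Edge G u y × Edge G v y → Edge G x y →
    Untouched D u v x → Untouched D u v y → T (mem D x y)
  clique-pair-edited diamond-free {u} {v} {x} {y} u≢v uv uv∈D x≢y
    x-common y-common xy x-free y-free =
    decidable-stable (T? _) λ xy∉D → diamond-free _ _ _ _
      ( x≢y , ≢-sym (adjacent-distinct G (proj₁ x-common))
      , ≢-sym (adjacent-distinct G (proj₂ x-common))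
      , ≢-sym (adjacent-distinct G (proj₁ y-common))
      , ≢-sym (adjacent-distinct G (proj₂ y-common)) , u≢v
      , kept-edge xy xy∉D
      , edge-sym G′ (proj₁ x′) , edge-sym G′ (proj₂ x′)
      , edge-sym G′ (proj₁ y′) , edge-sym G′ (proj₂ y′)
      , λ uv′ → Equivalence.to (edited-pair uv∈D) uv′ uv )
    where
    x′ : Edge G′ u x × Edge G′ v x
    x′ = untouched-edges x-common x-free
    y′ : Edge G′ u y × Edge G′ v y
    y′ = untouched-edges y-common y-free

  -- Case (ii): uv added, x y non-adjacent common neighbours untouched.
  -- Unless xy is edited as well, {u , v , x , y} induces a diamond in G′.
  independent-pair-edited : DiamondFree G′ → ∀ {u v x y} → u ≢ v →
    ¬ Edge G u v → T (mem D u v) → x ≢ y →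
    Edge G u x × Edge G v x → Edge G u y × Edge G v y → ¬ Edge G x y →
    Untouched D u v x → Untouched D u v y → T (mem D x y)
  independent-pair-edited diamond-free {u} {v} {x} {y} u≢v u≁v uv∈D x≢y
    x-common y-common x≁y x-free y-free =
    decidable-stable (T? _) λ xy∉D → diamond-free _ _ _ _
      ( u≢v , adjacent-distinct G (proj₁ x-common) , adjacent-distinct G (proj₁ y-common)
      , adjacent-distinct G (proj₂ x-common) , adjacent-distinct G (proj₂ y-common) , x≢y
      , Equivalence.from (edited-pair uv∈D) u≁v
      , proj₁ x′ , proj₁ y′ , proj₂ x′ , proj₂ y′
      , λ xy′ → x≁y (Equivalence.to (unedited-pair xy∉D) xy′) )
    where
    x′ : Edge G′ u x × Edge G′ v x
    x′ = untouched-edges x-common x-free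
    y′ : Edge G′ u y × Edge G′ v y
    y′ = untouched-edges y-common y-free

proposition2 : (n : ℕ) (G : Graph n) (k : ℕ) (Ep Em : PairSet n) →
    IsSolution G k Ep Em →
    (u v : Fin n) → u ≢ v →
    ((Edge G u v × CommonClique G u v (suc k)) ⊎ (¬ Edge G u v × CommonIndep G u v (suc k))) →
    ¬ T (mem (Ep ∪ₚ Em) u v)
proposition2 n G k Ep Em (Ep-non-edges , Em-edges , diamond-free , budget)
  u v u≢v protected uv∈D =
  1+n≰n (≤-trans (too-many-edits protected) budget)
  where
  open Editing G Ep Em Ep-non-edges Em-edges

  star-bound : (w : Fin (suc k) → Fin n) → (∀ i → Edge G u (w i) × Edge G v (w i)) →
    (∀ i j → i ≢ j → w i ≢ w j) →
    (∀ i j → i ≢ j → Untouched D u v (w i) → Untouched D u v (w j) → T (mem D (w i) (w j))) →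
    suc k ≤ ∣ D ∣ₚ
  star-bound w common w-distinct joined = StarCount.lower-bound D u v u≢v uv∈D w w-distinct
    (λ i → ≢-sym (adjacent-distinct G (proj₁ (common i))))
    (λ i → ≢-sym (adjacent-distinct G (proj₂ (common i)))) joined

  too-many-edits : (Edge G u v × CommonClique G u v (suc k)) ⊎
    (¬ Edge G u v × CommonIndep G u v (suc k)) → suc k ≤ ∣ D ∣ₚ
  too-many-edits (inj₁ (uv , w , common , clique)) =
    star-bound w common (λ i j i≢j → proj₁ (clique i j i≢j)) λ i j i≢j →
      clique-pair-edited diamond-free u≢v uv uv∈D (proj₁ (clique i j i≢j))
        (common i) (common j) (proj₂ (clique i j i≢j))
  too-many-edits (inj₂ (u≁v , w , common , independent)) =
    star-bound w common (λ i j i≢j → proj₁ (independent i j i≢j)) λ i j i≢j →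
      independent-pair-edited diamond-free u≢v u≁v uv∈D (proj₁ (independent i j i≢j))
        (common i) (common j) (proj₂ (independent i j i≢j))
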